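{- Let $G$ be a $3$-König–Egerváry graph and $e$ an edge of $G$. Then $e$ is $\alpha_3$-critical in $G$ if and only if (i) $e$ is $\mu_3$-critical in $G$, and (ii) $G-e$ is a $3$-König–Egerváry graph.
   Context: All graphs are finite, simple and undirected. A dissociation set of $G$ is a set $S$ of vertices such that $G[S]$ has maximum degree at most $1$, and $\alpha_3(G)$ is the maximum cardinality of a dissociation set. A $3$-path is a (not necessarily induced) subgraph isomorphic to the path on $3$ vertices; a $3$-matching is a set of pairwise vertex-disjoint $3$-paths, and $\mu_3(G)$ is the maximum number of paths in a $3$-matching. $G$ is $3$-König–Egerváry if $\alpha_3(G)+\mu_3(G)=|V(G)|$. An edge $e$ is $\alpha_3$-critical if $\alpha_3(G-e)>\alpha_3(G)$ and $\mu_3$-critical if $\mu_3(G-e)<\mu_3(G)$, where $G-e$ is obtained by deleting the edge $e$. -}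

module Defs where

open import Data.Nat using (ℕ; _≤_; _<_; _+_)
open import Data.Fin using (Fin)
open import Data.Fin.Subset using (Subset; _∈_; ∣_∣)
open import Data.List using (List; length; concatMap; _∷_; [])
open import Data.List.Relation.Unary.All using (All)
open import Data.List.Relation.Unary.Unique.Propositional using (Unique)
open import Data.Product using (Σ; ∃; ∃₂; _×_; _,_)
open import Data.Sum using (_⊎_)
open import Relation.Nullary using (¬_)
open import Relation.Binary.PropositionalEquality using (_≡_; _≢_)

record Graph (n : ℕ) : Set₁ where
  field
    Adj     : Fin n → Fin n → Set
    sym     : ∀ {x y} → Adj x y → Adj y x
    irrefl  : ∀ {x} → ¬ Adj x x
open Graph public

removeEdge : ∀ {n} → Graph n → Fin n → Fin n → Graph n
removeEdge G u v = record
  { Adj    = λ x y → Adj G x y × ¬ ((x ≡ u × y ≡ v) ⊎ (x ≡ v × y ≡ u))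
  ; sym    = λ { (a , h) → sym G a , λ { (_⊎_.inj₁ (p , q)) → h (_⊎_.inj₂ (q , p))
                                       ; (_⊎_.inj₂ (p , q)) → h (_⊎_.inj₁ (q , p)) } }
  ; irrefl = λ { (a , _) → irrefl G a }
  }

IsDissociation : ∀ {n} → Graph n → Subset n → Set
IsDissociation G S = ∀ {x y z} → x ∈ S → y ∈ S → z ∈ S →
                     Adj G x y → Adj G x z → y ≡ z

IsAlpha3 : ∀ {n} → Graph n → ℕ → Set
IsAlpha3 G k = (∃ λ S → IsDissociation G S × ∣ S ∣ ≡ k)
             × (∀ S → IsDissociation G S → ∣ S ∣ ≤ k)

-- A 3-path a - b - c (a subgraph isomorphic to P₃, not necessarily induced).
record Path3 {n : ℕ} (G : Graph n) : Set where
  constructor path3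
  field
    a b c : Fin n
    ab    : Adj G a b
    bc    : Adj G b c
    a≢c   : a ≢ c

pathVertices : ∀ {n} {G : Graph n} → Path3 G → List (Fin n)
pathVertices (path3 a b c _ _ _) = a ∷ b ∷ c ∷ []

Is3Matching : ∀ {n} {G : Graph n} → List (Path3 G) → Set
Is3Matching ps = Unique (concatMap pathVertices ps)

IsMu3 : ∀ {n} → Graph n → ℕ → Set
IsMu3 G m = (∃ λ (ps : List (Path3 G)) → Is3Matching ps × length ps ≡ m)
          × (∀ (ps : List (Path3 G)) → Is3Matching ps → length ps ≤ m)

Is3KE : ∀ {n} → Graph n → Set
Is3KE {n} G = ∃₂ λ a m → IsAlpha3 G a × IsMu3 G m × a + m ≡ n

IsAlpha3Critical : ∀ {n} → Graph n → Fin n → Fin n → Set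
IsAlpha3Critical G u v =
  ∃₂ λ a a' → IsAlpha3 G a × IsAlpha3 (removeEdge G u v) a' × a < a'

IsMu3Critical : ∀ {n} → Graph n → Fin n → Fin n → Set
IsMu3Critical G u v =
  ∃₂ λ m m' → IsMu3 G m × IsMu3 (removeEdge G u v) m' × m' < m

-- Every 3-path has a vertex outside any dissociation set S, and vertex-disjoint
-- paths give distinct such vertices, so α₃(G) + μ₃(G) ≤ |V(G)| for every graph;
-- a dissociation set and a 3-matching of total size |V(G)| are therefore both
-- optimal.  Deleting an edge uv destroys at most the one path of a 3-matching
-- through u, so μ₃(G − uv) ≥ μ₃(G) − 1.  If G is 3-König–Egerváry and
-- α₃(G − uv) > α₃(G), these two bounds squeeze G − uv into being
-- 3-König–Egerváry with μ₃(G − uv) = μ₃(G) − 1; conversely, if both graphs are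
-- 3-König–Egerváry, α₃ and μ₃ move in opposite directions.
module Submission where

open import Defs
open import Data.Nat using (ℕ; suc; _+_; _≤_; _<_; s≤s; z≤n)
open import Data.Nat.Properties
  using (≤-antisym; ≤-trans; ≤-reflexive; +-suc; +-identityʳ; +-monoˡ-≤; +-monoʳ-≤; +-cancelˡ-≤; +-cancelʳ-≤; module ≤-Reasoning)
open import Data.Fin using (Fin; _≟_)
open import Data.Fin.Subset using (Subset; _∉_; _∪_; ⁅_⁆; ∣_∣)
open import Data.Fin.Subset.Properties
  using (_∈?_; ∣p∣≤n; p⊂q⇒∣p∣<∣q∣; p⊆p∪q; q⊆p∪q; x∈p∪q⁻; x∈⁅x⁆; x∈⁅y⁆⇒x≡y)
open import Data.List using (List; []; _∷_; _++_; length; map; concatMap)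
open import Data.List.Properties using (length-map)
open import Data.List.Membership.Propositional using (_∈_)
open import Data.List.Relation.Unary.All as All using (All; []; _∷_)
open import Data.List.Relation.Unary.All.Properties using (All¬⇒¬Any; ++⁻ˡ; ++⁻ʳ; map⁺)
open import Data.List.Relation.Unary.Any using (here; there; any?)
open import Data.List.Relation.Unary.AllPairs using ([]; _∷_)
open import Data.List.Relation.Unary.Unique.Propositional using (Unique)
open import Data.List.Relation.Binary.Sublist.Propositional using (_⊆_; []; _∷_; _∷ʳ_; ⊆-refl)
open import Data.List.Relation.Binary.Sublist.Propositional.Properties using (All-resp-⊆; ++⁺; ++⁺ˡ)
open import Data.Product using (∃; _×_; _,_; proj₁; proj₂)
open import Data.Sum using (inj₁; inj₂; [_,_]′)
open import Data.Empty using (⊥-elim)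
open import Function.Bundles using (_⇔_; mk⇔)
open import Relation.Nullary using (¬_; yes; no)
open import Relation.Binary.PropositionalEquality as ≡ using (_≡_; _≢_; refl)

Maximum : {A : Set} → (A → Set) → (A → ℕ) → ℕ → Set
Maximum P f k = (∃ λ x → P x × f x ≡ k) × (∀ x → P x → f x ≤ k)

module _ {A : Set} {P : A → Set} {f : A → ℕ} where

  Maximum-unique : ∀ {k l} → Maximum P f k → Maximum P f l → k ≡ l
  Maximum-unique ((x , Px , refl) , k-max) ((y , Py , refl) , l-max) =
    ≤-antisym (l-max x Px) (k-max y Py)

module _ {A B : Set} {P : A → Set} {Q : B → Set} {f : A → ℕ} {g : B → ℕ} {N : ℕ}
         (weak-duality : ∀ {x y} → P x → Q y → f x + g y ≤ N) where

  tight⇒Maximum : ∀ {x y} → P x → Q y → f x + g y ≡ N → Maximum P f (f x) × Maximum Q g (g y)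
  tight⇒Maximum {x} {y} Px Qy fx+gy≡N =
    ((x , Px , refl) , λ x′ Px′ → +-cancelʳ-≤ (g y) _ _ (≤fx+gy (weak-duality Px′ Qy))) ,
    ((y , Qy , refl) , λ y′ Qy′ → +-cancelˡ-≤ (f x) _ _ (≤fx+gy (weak-duality Px Qy′)))
    where
    ≤fx+gy : ∀ {k} → k ≤ N → k ≤ f x + g y
    ≤fx+gy k≤N = ≤-trans k≤N (≤-reflexive (≡.sym fx+gy≡N))

x∉p⇒∣p∣<∣p∪⁅x⁆∣ : ∀ {n} {p : Subset n} {x : Fin n} → x ∉ p → ∣ p ∣ < ∣ p ∪ ⁅ x ⁆ ∣
x∉p⇒∣p∣<∣p∪⁅x⁆∣ {p = p} {x} x∉p = p⊂q⇒∣p∣<∣q∣ (p⊆p∪q ⁅ x ⁆ , x , q⊆p∪q p ⁅ x ⁆ (x∈⁅x⁆ x) , x∉p)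

y∉p∪⁅x⁆ : ∀ {n} {p : Subset n} {x y : Fin n} → x ≢ y → y ∉ p → y ∉ p ∪ ⁅ x ⁆
y∉p∪⁅x⁆ {p = p} {x} x≢y y∉p y∈p∪⁅x⁆ =
  [ y∉p , (λ y∈⁅x⁆ → x≢y (≡.sym (x∈⁅y⁆⇒x≡y x y∈⁅x⁆))) ]′ (x∈p∪q⁻ p ⁅ x ⁆ y∈p∪⁅x⁆)

∣p∣+length≤n : ∀ {n} (p : Subset n) {xs : List (Fin n)} → Unique xs → All (_∉ p) xs →
               ∣ p ∣ + length xs ≤ n
∣p∣+length≤n p {[]} _ _ = ≤-trans (≤-reflexive (+-identityʳ ∣ p ∣)) (∣p∣≤n p)
∣p∣+length≤n {n} p {x ∷ xs} (x∉xs ∷ xs-unique) (x∉p ∷ xs∉p) = begin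
  ∣ p ∣ + suc (length xs)    ≡⟨ +-suc ∣ p ∣ (length xs) ⟩
  suc ∣ p ∣ + length xs      ≤⟨ +-monoˡ-≤ (length xs) (x∉p⇒∣p∣<∣p∪⁅x⁆∣ x∉p) ⟩
  ∣ p ∪ ⁅ x ⁆ ∣ + length xs  ≤⟨ ∣p∣+length≤n (p ∪ ⁅ x ⁆) xs-unique xs∉p∪⁅x⁆ ⟩
  n                          ∎
  where
  open ≤-Reasoning
  xs∉p∪⁅x⁆ : All (_∉ p ∪ ⁅ x ⁆) xs
  xs∉p∪⁅x⁆ = All.zipWith (λ (x≢y , y∉p) → y∉p∪⁅x⁆ x≢y y∉p) (x∉xs , xs∉p)

Unique-resp-⊇ : ∀ {A : Set} {xs ys : List A} → xs ⊆ ys → Unique ys → Unique xs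
Unique-resp-⊇ []          []                 = []
Unique-resp-⊇ (_ ∷ʳ xs⊆ys) (_ ∷ ys-unique)    = Unique-resp-⊇ xs⊆ys ys-unique
Unique-resp-⊇ (refl ∷ xs⊆ys) (y∉ys ∷ ys-unique) = All-resp-⊆ xs⊆ys y∉ys ∷ Unique-resp-⊇ xs⊆ys ys-unique

Unique-++⇒∉ʳ : ∀ {A : Set} {x : A} (xs : List A) {ys : List A} → Unique (xs ++ ys) → x ∈ xs → All (x ≢_) ys
Unique-++⇒∉ʳ (_ ∷ xs) (x∉xs++ys ∷ _) (here refl)   = ++⁻ʳ xs x∉xs++ys
Unique-++⇒∉ʳ (_ ∷ xs) (_ ∷ xs++ys-unique) (there x∈xs) = Unique-++⇒∉ʳ xs xs++ys-unique x∈xs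

module _ {n} (G : Graph n) (S : Subset n) (S-dissociation : IsDissociation G S) where

  Path3-vertex∉dissociation : (p : Path3 G) → ∃ λ x → x ∉ S × (x ∷ []) ⊆ pathVertices p
  Path3-vertex∉dissociation (path3 a b c ab bc a≢c) with a ∈? S | b ∈? S | c ∈? S
  ... | no a∉S | _       | _       = a , a∉S , refl ∷ b ∷ʳ c ∷ʳ []
  ... | yes _  | no b∉S  | _       = b , b∉S , a ∷ʳ refl ∷ c ∷ʳ []
  ... | yes _  | yes _   | no c∉S  = c , c∉S , a ∷ʳ b ∷ʳ refl ∷ []
  ... | yes a∈S | yes b∈S | yes c∈S = ⊥-elim (a≢c (S-dissociation b∈S a∈S c∈S (sym G ab) bc))

  private
    outside : Path3 G → Fin n
    outside p = proj₁ (Path3-vertex∉dissociation p)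

    outside-⊆ : (ps : List (Path3 G)) → map outside ps ⊆ concatMap pathVertices ps
    outside-⊆ []       = []
    outside-⊆ (p ∷ ps) = ++⁺ (proj₂ (proj₂ (Path3-vertex∉dissociation p))) (outside-⊆ ps)

  ∣dissociation∣+∣3-matching∣≤n : (ps : List (Path3 G)) → Is3Matching ps → ∣ S ∣ + length ps ≤ n
  ∣dissociation∣+∣3-matching∣≤n ps ps-matching =
    ≡.subst (λ k → ∣ S ∣ + k ≤ n) (length-map outside ps)
      (∣p∣+length≤n S (Unique-resp-⊇ (outside-⊆ ps) ps-matching)
        (map⁺ (All.universal (λ p → proj₁ (proj₂ (Path3-vertex∉dissociation p))) ps)))

tight⇒IsAlpha3×IsMu3 : ∀ {n} (G : Graph n) (S : Subset n) (ps : List (Path3 G)) →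
                       IsDissociation G S → Is3Matching ps → ∣ S ∣ + length ps ≡ n →
                       IsAlpha3 G ∣ S ∣ × IsMu3 G (length ps)
tight⇒IsAlpha3×IsMu3 G S ps =
  tight⇒Maximum {P = IsDissociation G} {Q = Is3Matching}
    (λ {S′} {ps′} S′-dissociation → ∣dissociation∣+∣3-matching∣≤n G S′ S′-dissociation ps′) {S} {ps}

module _ {n} (G : Graph n) (u v : Fin n) where

  Adj-removeEdge : ∀ {x y} → Adj G x y → u ≢ x → u ≢ y → Adj (removeEdge G u v) x y
  Adj-removeEdge xy u≢x u≢y = xy , λ { (inj₁ (x≡u , _)) → u≢x (≡.sym x≡u)
                                      ; (inj₂ (_ , y≡u)) → u≢y (≡.sym y≡u) }

  Path3-removeEdge : (p : Path3 G) → ¬ u ∈ pathVertices p → Path3 (removeEdge G u v)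
  Path3-removeEdge (path3 a b c ab bc a≢c) u∉p = path3 a b c
    (Adj-removeEdge ab (λ u≡a → u∉p (here u≡a)) (λ u≡b → u∉p (there (here u≡b))))
    (Adj-removeEdge bc (λ u≡b → u∉p (there (here u≡b))) (λ u≡c → u∉p (there (there (here u≡c)))))
    a≢c

  pathsAvoiding : List (Path3 G) → List (Path3 (removeEdge G u v))
  pathsAvoiding []       = []
  pathsAvoiding (p ∷ ps) with any? (u ≟_) (pathVertices p)
  ... | yes _   = pathsAvoiding ps
  ... | no u∉p  = Path3-removeEdge p u∉p ∷ pathsAvoiding ps

  pathsAvoiding-⊆ : ∀ ps → concatMap pathVertices (pathsAvoiding ps) ⊆ concatMap pathVertices ps
  pathsAvoiding-⊆ []       = []
  pathsAvoiding-⊆ (p ∷ ps) with any? (u ≟_) (pathVertices p)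
  ... | yes _ = ++⁺ˡ (pathVertices p) (pathsAvoiding-⊆ ps)
  ... | no _  = ++⁺ ⊆-refl (pathsAvoiding-⊆ ps)

  length-pathsAvoiding : ∀ ps → All (u ≢_) (concatMap pathVertices ps) → length (pathsAvoiding ps) ≡ length ps
  length-pathsAvoiding []       _   = refl
  length-pathsAvoiding (p ∷ ps) u∉ with any? (u ≟_) (pathVertices p)
  ... | yes u∈p = ⊥-elim (All¬⇒¬Any (++⁻ˡ (pathVertices p) u∉) u∈p)
  ... | no _    = ≡.cong suc (length-pathsAvoiding ps (++⁻ʳ (pathVertices p) u∉))

  length≤1+length-pathsAvoiding : ∀ ps → Is3Matching ps → length ps ≤ suc (length (pathsAvoiding ps))
  length≤1+length-pathsAvoiding []       _           = z≤n
  length≤1+length-pathsAvoiding (p ∷ ps) ps-matching with any? (u ≟_) (pathVertices p)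
  ... | yes u∈p = s≤s (≤-reflexive (≡.sym (length-pathsAvoiding ps (Unique-++⇒∉ʳ (pathVertices p) ps-matching u∈p))))
  ... | no _    = s≤s (length≤1+length-pathsAvoiding ps (Unique-resp-⊇ (++⁺ˡ (pathVertices p) ⊆-refl) ps-matching))

  Is3Matching-removeEdge : ∀ ps → Is3Matching ps →
    ∃ λ (qs : List (Path3 (removeEdge G u v))) → Is3Matching qs × length ps ≤ suc (length qs)
  Is3Matching-removeEdge ps ps-matching =
    pathsAvoiding ps , Unique-resp-⊇ (pathsAvoiding-⊆ ps) ps-matching , length≤1+length-pathsAvoiding ps ps-matching

+-squeeze : ∀ {a b m q n} → a + m ≡ n → a < b → m ≤ suc q → b + q ≤ n → b + q ≡ n × q < m
+-squeeze {a} {b} {m} {q} {n} a+m≡n a<b m≤1+q b+q≤n = ≤-antisym b+q≤n n≤b+q , q<m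
  where
  open ≤-Reasoning
  1+a+q≤b+q : suc a + q ≤ b + q
  1+a+q≤b+q = +-monoˡ-≤ q a<b
  n≤b+q : n ≤ b + q
  n≤b+q = begin
    n          ≡⟨ ≡.sym a+m≡n ⟩
    a + m      ≤⟨ +-monoʳ-≤ a m≤1+q ⟩
    a + suc q  ≡⟨ +-suc a q ⟩
    suc a + q  ≤⟨ 1+a+q≤b+q ⟩
    b + q      ∎
  q<m : q < m
  q<m = +-cancelˡ-≤ a (suc q) m (begin
    a + suc q  ≡⟨ +-suc a q ⟩
    suc a + q  ≤⟨ 1+a+q≤b+q ⟩
    b + q      ≤⟨ b+q≤n ⟩
    n          ≡⟨ ≡.sym a+m≡n ⟩
    a + m      ∎)

+-≡-<ʳ⇒<ˡ : ∀ {a b m k} → a + m ≡ b + k → k < m → a < b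
+-≡-<ʳ⇒<ˡ {a} {b} {m} {k} a+m≡b+k k<m = +-cancelʳ-≤ k (suc a) b (begin
  suc a + k  ≡⟨ +-suc a k ⟨
  a + suc k  ≤⟨ +-monoʳ-≤ a k<m ⟩
  a + m      ≡⟨ a+m≡b+k ⟩
  b + k      ∎)
  where open ≤-Reasoning

lemma3p3 : ∀ {n : ℕ} (G : Graph n) → Is3KE G →
           ∀ (u v : Fin n) → Adj G u v →
           IsAlpha3Critical G u v ⇔ (IsMu3Critical G u v × Is3KE (removeEdge G u v))
-- The argument never uses that uv is an edge of G.
lemma3p3 {n} G (a , m , α₃G , μ₃G@((ps , ps-matching , refl) , _) , a+m≡n) u v _ = mk⇔ to from
  where
  H = removeEdge G u v

  to : IsAlpha3Critical G u v → IsMu3Critical G u v × Is3KE H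
  to (a₀ , _ , α₃G₀ , ((S , S-dissociation , refl) , _) , a₀<∣S∣) =
    let a<∣S∣                      = ≡.subst (_< ∣ S ∣) (Maximum-unique α₃G₀ α₃G) a₀<∣S∣
        (qs , qs-matching , m≤1+q) = Is3Matching-removeEdge G u v ps ps-matching
        (tight , q<m)              = +-squeeze a+m≡n a<∣S∣ m≤1+q
                                       (∣dissociation∣+∣3-matching∣≤n H S S-dissociation qs qs-matching)
        (α₃H , μ₃H)                = tight⇒IsAlpha3×IsMu3 H S qs S-dissociation qs-matching tight
    in (m , length qs , μ₃G , μ₃H , q<m) , (∣ S ∣ , length qs , α₃H , μ₃H , tight)

  from : IsMu3Critical G u v × Is3KE H → IsAlpha3Critical G u v
  from ((m₀ , m′ , μ₃G₀ , μ₃H , m′<m₀) , (a′ , m″ , α₃H , μ₃H′ , a′+m″≡n)) =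
    let a′+m′≡n = ≡.subst (λ k → a′ + k ≡ n) (Maximum-unique μ₃H′ μ₃H) a′+m″≡n
        m′<m    = ≡.subst (m′ <_) (Maximum-unique μ₃G₀ μ₃G) m′<m₀
    in a , a′ , α₃G , α₃H , +-≡-<ʳ⇒<ˡ (≡.trans a+m≡n (≡.sym a′+m′≡n)) m′<m
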